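{- Let $v$ be a vertex of $Y_{n,m}$ and let $p$ be a pivot of $v$. Then $$\mathrm{ps}_p(v)=\sum_{i=1}^{p}iv_i+\sum_{i=p+1}^{m}(m+1-i)v_i .$$ In particular, if $p$ is an inner pivot, then $\mathrm{ps}_p(v)\leq\binom{p+1}{2}+\binom{m-p+1}{2}$.
   Context: For integers $n\geq 1$, $m\geq 0$, the Yoke graph $Y_{n,m}$ has vertices the tuples $v=(v_0,\dots,v_{m+1})$ with $v_0,v_{m+1}\in\mathbb{Z}_n$, $v_1,\dots,v_m\in\{0,1\}$ and $\sum v_i\equiv0\pmod n$; bucket entries $v_0,v_{m+1}$ are identified with their least nonnegative representatives in $\{0,\dots,n-1\}$, so sums of entries are integers. $0$ is the all-zero vertex. Edges: from $x$ to $y$ is a left shift at position $i$ ($0\leq i\leq m$) if $y_j=x_j$ for $j\notin\{i,i+1\}$, $y_i=x_i+1$, $y_{i+1}=x_{i+1}-1$, a right shift at $i$ if $y_i=x_i-1$, $y_{i+1}=x_{i+1}+1$ (bucket coordinates in $\mathbb{Z}_n$, entries in allowed sets). A pivot of $v$ is an integer $-1\leq p\leq m+1$ with $\sum_{i=0}^{p}v_i$ divisible by $n$ ($-1$ and $m+1$ are always pivots; other pivots are inner). For a path $P$ from $v$ to $0$: $0\leq p\leq m$ is a wall of $P$ if no step is a shift at position $p$; $-1$ is a wall if no step is a left shift at position $0$; $m+1$ is a wall if no step is a right shift at position $m$. $\mathrm{ps}_p(v)$ is the minimum length of a path from $v$ to $0$ having $p$ as a wall. -}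

module Defs where

open import Data.Nat using (ℕ; zero; suc; _+_; _*_; _∸_; _≤_; _<_)
open import Data.Nat.Divisibility using (_∣_)
open import Data.Nat.Combinatorics using (_C_)
open import Data.Integer using (ℤ; +_; -[1+_])
open import Data.List using (List; []; _∷_; length)
open import Data.List.Relation.Unary.All using (All)
open import Data.Product using (Σ; _×_; _,_)
open import Data.Sum using (_⊎_)
open import Relation.Nullary using (¬_)
open import Relation.Binary.PropositionalEquality using (_≡_; _≢_)

-- A (candidate) vertex of Y_{n,m}: coordinate i ↦ v_i, for 0 ≤ i ≤ m+1
-- (values at indices > m+1 are irrelevant and never inspected).
-- Bucket entries v_0, v_{m+1} are stored as their representatives in {0,…,n-1}.
Vtx : Set
Vtx = ℕ → ℕ

sumBelow : (ℕ → ℕ) → ℕ → ℕ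
sumBelow f zero    = 0
sumBelow f (suc k) = sumBelow f k + f k

sumFrom : (ℕ → ℕ) → ℕ → ℕ → ℕ
sumFrom f a k = sumBelow (λ i → f (a + i)) k

IsBucket : ℕ → ℕ → Set
IsBucket m j = (j ≡ 0) ⊎ (j ≡ suc m)

IsVertex : ℕ → ℕ → Vtx → Set
IsVertex n m v =
  (v 0 < n) × (v (suc m) < n) ×
  (∀ i → 1 ≤ i → i ≤ m → v i ≤ 1) ×
  (n ∣ sumBelow v (suc (suc m)))

IsZeroVertex : ℕ → Vtx → Set
IsZeroVertex m v = ∀ j → j ≤ suc m → v j ≡ 0

-- b = a + 1 at coordinate j (in ℤ_n for buckets, in {0,1} for inner coordinates;
-- membership in {0,1} is enforced by the target being a vertex)
IncAt : ℕ → ℕ → ℕ → ℕ → ℕ → Set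
IncAt n m j a b =
  (IsBucket m j → (b ≡ a + 1) ⊎ ((a + 1 ≡ n) × (b ≡ 0))) ×
  (¬ IsBucket m j → b ≡ a + 1)

DecAt : ℕ → ℕ → ℕ → ℕ → ℕ → Set
DecAt n m j a b = IncAt n m j b a

data Dir : Set where
  L R : Dir

Shift : ℕ → ℕ → Dir → ℕ → Vtx → Vtx → Set
Shift n m d i x y =
  (i ≤ m) ×
  (∀ j → j ≤ suc m → j ≢ i → j ≢ suc i → y j ≡ x j) ×
  shiftCore d
  where
  shiftCore : Dir → Set
  shiftCore L = IncAt n m i (x i) (y i) × DecAt n m (suc i) (x (suc i)) (y (suc i))
  shiftCore R = DecAt n m i (x i) (y i) × IncAt n m (suc i) (x (suc i)) (y (suc i))

data Path (n m : ℕ) : Vtx → Set where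
  done : ∀ {x} → IsZeroVertex m x → Path n m x
  step : ∀ {x y} (d : Dir) (i : ℕ) → Shift n m d i x y → IsVertex n m y →
         Path n m y → Path n m x

labels : ∀ {n m x} → Path n m x → List (Dir × ℕ)
labels (done _)           = []
labels (step d i _ _ rest) = (d , i) ∷ labels rest

pathLength : ∀ {n m x} → Path n m x → ℕ
pathLength P = length (labels P)

-- Is the step (d , i) compatible with p being a wall?
-- p = -1 : the step is not a left shift at 0;
-- p = k ∈ {0..m} : the step is not a shift at position k;
-- p = m+1 : the step is not a right shift at m.
NotBlockedBy : ℕ → ℤ → Dir × ℕ → Set
NotBlockedBy m -[1+ _ ] (d , i) = ¬ ((d ≡ L) × (i ≡ 0))
NotBlockedBy m (+ k)    (d , i) = (i ≢ k) × (k ≡ suc m → ¬ ((d ≡ R) × (i ≡ m)))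

IsWall : ∀ {n m x} → ℤ → Path n m x → Set
IsWall {m = m} p P = All (NotBlockedBy m p) (labels P)

prefixSum : Vtx → ℤ → ℕ
prefixSum v -[1+ _ ] = 0
prefixSum v (+ k)    = sumBelow v (suc k)

InRange : ℕ → ℤ → Set
InRange m -[1+ k ] = k ≡ 0
InRange m (+ k)    = k ≤ suc m

IsPivot : ℕ → ℕ → Vtx → ℤ → Set
IsPivot n m v p = InRange m p × (n ∣ prefixSum v p)

IsPs : ℕ → ℕ → Vtx → ℤ → ℕ → Set
IsPs n m v p k =
  (Σ (Path n m v) λ P → IsWall p P × (pathLength P ≡ k)) ×
  (∀ (P : Path n m v) → IsWall p P → k ≤ pathLength P)

psFormula : ℕ → Vtx → ℤ → ℕ
psFormula m v -[1+ _ ] = sumFrom (λ i → (suc m ∸ i) * v i) 0 (suc m)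
psFormula m v (+ k)    =
  sumFrom (λ i → i * v i) 1 k + sumFrom (λ i → (suc m ∸ i) * v i) (suc k) (m ∸ k)

innerBound : ℕ → ℕ → ℕ
innerBound m k = (suc k C 2) + (suc (m ∸ k) C 2)

-- Put w_p(j) = j for j ≤ p and w_p(j) = m+1-j for j > p, and Φ(v) = Σ_j w_p(j) v_j; the claimed
-- value of ps_p(v) is Φ(v).  A shift not blocked by the wall p moves one unit between adjacent
-- coordinates whose weights differ by at most one, and a bucket that wraps around from n-1 to 0
-- has weight 0; so every step lowers Φ by at most one, and every path to 0 with wall p has
-- length at least Φ(v).  Conversely, while Φ(v) > 0 some unit has positive weight: left of the
-- wall a unit whose left neighbour is empty (or is bucket 0) can move left, right of the wall a
-- unit whose right neighbour is empty (or is bucket m+1) can move right.  Such a step lowers Φ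
-- by exactly one, keeps v a vertex and keeps p a pivot, and once Φ(v) = 0 the pivot condition
-- forces v = 0.  The inner bound is Φ(v) ≤ Σ_{i≤p} i + Σ_{i>p} (m+1-i), since v_i ≤ 1.
module Submission where

open import Defs
open import Data.Nat
open import Data.Nat.Properties
open import Data.Nat.Divisibility using (_∣_; ∣-refl; ∣m∣n⇒∣m+n; ∣m+n∣m⇒∣n; >⇒∤)
open import Data.Nat.Combinatorics using (_C_; nC1≡n; nCk+nC[k+1]≡[n+1]C[k+1])
open import Data.Nat.Tactic.RingSolver using (solve-∀)
open import Data.Integer using (ℤ; +_; -[1+_])
open import Data.List.Relation.Unary.All using ([]; _∷_)
open import Data.Product using (Σ; ∃-syntax; _×_; _,_; proj₁; proj₂)
open import Data.Sum using (_⊎_; inj₁; inj₂; map₁)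
open import Relation.Nullary using (Dec; yes; no; contradiction)
open import Relation.Nullary.Decidable using (_⊎-dec_)
open import Relation.Binary.PropositionalEquality
open import Relation.Binary.Definitions using (tri<; tri≈; tri>)
open import Function using (_∘_)

-- Finite sums

sumBelow-cong : ∀ {f g : ℕ → ℕ} N → (∀ i → i < N → f i ≡ g i) → sumBelow f N ≡ sumBelow g N
sumBelow-cong zero    _  = refl
sumBelow-cong (suc N) eq = cong₂ _+_ (sumBelow-cong N (λ i i<N → eq i (m<n⇒m<1+n i<N))) (eq N ≤-refl)

sumBelow-mono-≤ : ∀ {f g : ℕ → ℕ} N → (∀ i → i < N → f i ≤ g i) → sumBelow f N ≤ sumBelow g N
sumBelow-mono-≤ zero    _  = z≤n
sumBelow-mono-≤ (suc N) le = +-mono-≤ (sumBelow-mono-≤ N (λ i i<N → le i (m<n⇒m<1+n i<N))) (le N ≤-refl)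

sumBelow-≡0 : ∀ {f : ℕ → ℕ} N → (∀ i → i < N → f i ≡ 0) → sumBelow f N ≡ 0
sumBelow-≡0 zero    _  = refl
sumBelow-≡0 (suc N) eq = cong₂ _+_ (sumBelow-≡0 N (λ i i<N → eq i (m<n⇒m<1+n i<N))) (eq N ≤-refl)

sumBelow≡0⇒≡0 : ∀ {f : ℕ → ℕ} N → sumBelow f N ≡ 0 → ∀ i → i < N → f i ≡ 0
sumBelow≡0⇒≡0 {f} (suc N) eq i i<1+N with m≤n⇒m<n∨m≡n (s≤s⁻¹ i<1+N)
... | inj₁ i<N  = sumBelow≡0⇒≡0 N (m+n≡0⇒m≡0 _ eq) i i<N
... | inj₂ refl = m+n≡0⇒n≡0 (sumBelow f N) eq

sumBelow≢0⇒∃≢0 : ∀ {f : ℕ → ℕ} N → sumBelow f N ≢ 0 → ∃[ i ] i < N × f i ≢ 0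
sumBelow≢0⇒∃≢0 zero    ne = contradiction refl ne
sumBelow≢0⇒∃≢0 {f} (suc N) ne with f N ≟ 0
... | no  fN≢0 = N , ≤-refl , fN≢0
... | yes fN≡0 with sumBelow≢0⇒∃≢0 N (λ sum≡0 → ne (cong₂ _+_ sum≡0 fN≡0))
...   | i , i<N , fi≢0 = i , m<n⇒m<1+n i<N , fi≢0

sumBelow-+ : ∀ (f : ℕ → ℕ) a b → sumBelow f (a + b) ≡ sumBelow f a + sumFrom f a b
sumBelow-+ f a zero    = trans (cong (sumBelow f) (+-identityʳ a)) (sym (+-identityʳ _))
sumBelow-+ f a (suc b) = begin
  sumBelow f (a + suc b)                    ≡⟨ cong (sumBelow f) (+-suc a b) ⟩
  sumBelow f (a + b) + f (a + b)            ≡⟨ cong (_+ f (a + b)) (sumBelow-+ f a b) ⟩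
  sumBelow f a + sumFrom f a b + f (a + b)  ≡⟨ +-assoc (sumBelow f a) _ _ ⟩
  sumBelow f a + sumFrom f a (suc b)        ∎
  where open ≡-Reasoning

sumBelow-head : ∀ {f : ℕ → ℕ} {N} → 0 < N → (∀ i → 0 < i → i < N → f i ≡ 0) → sumBelow f N ≡ f 0
sumBelow-head {f} {suc N} _ eq = begin
  sumBelow f (1 + N)   ≡⟨ sumBelow-+ f 1 N ⟩
  f 0 + sumFrom f 1 N  ≡⟨ cong (λ s → f 0 + s) (sumBelow-≡0 N (λ i i<N → eq (suc i) z<s (s<s i<N))) ⟩
  f 0 + 0              ≡⟨ +-identityʳ (f 0) ⟩
  f 0                  ∎
  where open ≡-Reasoning

-- For k ≤ m the left sum has the one extra term f (suc m); for k > m both sums are empty.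
sumFrom-drop-top : ∀ (f : ℕ → ℕ) m k → f (suc m) ≡ 0 →
  sumFrom f (suc k) (suc m ∸ k) ≡ sumFrom f (suc k) (m ∸ k)
sumFrom-drop-top f m       zero    top≡0 = trans (cong (λ s → sumFrom f 1 m + s) top≡0) (+-identityʳ _)
sumFrom-drop-top f zero    (suc k) _     = cong (sumFrom f (2 + k)) (0∸n≡0 k)
sumFrom-drop-top f (suc m) (suc k) top≡0 = sumFrom-drop-top (λ i → f (suc i)) m k top≡0

sumBelow-exchange : ∀ {f g : ℕ → ℕ} {i} N → suc i < N →
  (∀ j → j < N → j ≢ i → j ≢ suc i → f j ≡ g j) →
  sumBelow f N + (g i + g (suc i)) ≡ sumBelow g N + (f i + f (suc i))
sumBelow-exchange {f} {g} {i} (suc N) 1+i<1+N agree with m≤n⇒m<n∨m≡n (s≤s⁻¹ 1+i<1+N)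
... | inj₁ 1+i<N = begin
  sumBelow f N + f N + (g i + g (suc i))  ≡⟨ swap (sumBelow f N) (f N) _ ⟩
  sumBelow f N + (g i + g (suc i)) + f N  ≡⟨ cong₂ _+_ (sumBelow-exchange N 1+i<N agree<N) fN≡gN ⟩
  sumBelow g N + (f i + f (suc i)) + g N  ≡⟨ swap (sumBelow g N) _ (g N) ⟩
  sumBelow g N + g N + (f i + f (suc i))  ∎
  where
  open ≡-Reasoning
  swap : ∀ a b c → a + b + c ≡ a + c + b
  swap = solve-∀
  agree<N : ∀ j → j < N → j ≢ i → j ≢ suc i → f j ≡ g j
  agree<N j j<N = agree j (m<n⇒m<1+n j<N)
  fN≡gN : f N ≡ g N
  fN≡gN = agree N ≤-refl (λ N≡i → <⇒≢ (<-trans (n<1+n i) 1+i<N) (sym N≡i)) (λ N≡1+i → <⇒≢ 1+i<N (sym N≡1+i))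
... | inj₂ refl = begin
  sumBelow f i + f i + f (suc i) + (g i + g (suc i))
    ≡⟨ cong (λ s → s + f i + f (suc i) + (g i + g (suc i))) below ⟩
  sumBelow g i + f i + f (suc i) + (g i + g (suc i))
    ≡⟨ swap₂ (sumBelow g i) (f i) (f (suc i)) (g i) (g (suc i)) ⟩
  sumBelow g i + g i + g (suc i) + (f i + f (suc i))  ∎
  where
  open ≡-Reasoning
  swap₂ : ∀ s a b c d → s + a + b + (c + d) ≡ s + c + d + (a + b)
  swap₂ = solve-∀
  below : sumBelow f i ≡ sumBelow g i
  below = sumBelow-cong i (λ j j<i → agree j (<-trans j<i (<-trans (n<1+n i) (n<1+n (suc i))))
                                            (<⇒≢ j<i) (<⇒≢ (m<n⇒m<1+n j<i)))

sumBelow-suc : ∀ (f : ℕ → ℕ) d → sumBelow (λ i → suc (f i)) d ≡ sumBelow f d + d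
sumBelow-suc f zero    = refl
sumBelow-suc f (suc d) = trans (cong (_+ suc (f d)) (sumBelow-suc f d)) (shuffle (sumBelow f d) d (f d))
  where
  shuffle : ∀ s d a → s + d + suc a ≡ s + a + suc d
  shuffle = solve-∀

sumBelow-∸ : ∀ d → sumBelow (d ∸_) d ≡ sumBelow suc d
sumBelow-∸ zero    = refl
sumBelow-∸ (suc d) = begin
  sumBelow (suc d ∸_) d + (suc d ∸ d)        ≡⟨ cong₂ _+_ (sumBelow-cong d (λ i i<d → +-∸-assoc 1 (<⇒≤ i<d)))
                                                          (m+n∸n≡m 1 d) ⟩
  sumBelow (λ i → suc (d ∸ i)) d + 1         ≡⟨ cong (_+ 1) (sumBelow-suc (d ∸_) d) ⟩
  sumBelow (d ∸_) d + d + 1                  ≡⟨ cong (λ s → s + d + 1) (sumBelow-∸ d) ⟩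
  sumBelow suc d + d + 1                     ≡⟨ +-assoc (sumBelow suc d) d 1 ⟩
  sumBelow suc d + (d + 1)                   ≡⟨ cong (λ s → sumBelow suc d + s) (+-comm d 1) ⟩
  sumBelow suc (suc d)                       ∎
  where open ≡-Reasoning

triangle : ∀ d → sumBelow suc d ≡ suc d C 2
triangle zero    = refl
triangle (suc d) = begin
  sumBelow suc d + suc d  ≡⟨ cong (_+ suc d) (triangle d) ⟩
  suc d C 2 + suc d       ≡⟨ +-comm (suc d C 2) (suc d) ⟩
  suc d + suc d C 2       ≡⟨ cong (_+ suc d C 2) (sym (nC1≡n (suc d))) ⟩
  suc d C 1 + suc d C 2   ≡⟨ nCk+nC[k+1]≡[n+1]C[k+1] (suc d) 1 ⟩
  suc (suc d) C 2         ∎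
  where open ≡-Reasoning

weighted≤ : ∀ c {a} → a ≤ 1 → c * a ≤ c
weighted≤ c a≤1 = ≤-trans (*-monoʳ-≤ c a≤1) (≤-reflexive (*-identityʳ c))

*≢0⇒≢0 : ∀ a b → a * b ≢ 0 → a ≢ 0 × b ≢ 0
*≢0⇒≢0 a b ab≢0 = (λ a≡0 → ab≢0 (cong (_* b) a≡0)) , (λ b≡0 → ab≢0 (trans (cong (a *_) b≡0) (*-zeroʳ a)))

∣∧<⇒≡0 : ∀ {n a} → n ∣ a → a < n → a ≡ 0
∣∧<⇒≡0 {a = zero}  _   _   = refl
∣∧<⇒≡0 {a = suc a} n∣a a<n = contradiction n∣a (>⇒∤ a<n)

-- How a sum changes when some bucket wraps around modulo n.
UpToWrap : ℕ → ℕ → ℕ → Set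
UpToWrap n a b = a ≡ b ⊎ a ≡ b + n ⊎ b ≡ a + n

∣-transfer : ∀ {n X Y a b} → X + b ≡ Y + a → UpToWrap n a b → n ∣ X → n ∣ Y
∣-transfer {X = X} {Y} {a} e (inj₁ refl) n∣X = subst (_ ∣_) (+-cancelʳ-≡ a X Y e) n∣X
∣-transfer {n} {X} {Y} {b = b} e (inj₂ (inj₁ refl)) n∣X =
  ∣m+n∣m⇒∣n (subst (n ∣_) X≡n+Y n∣X) ∣-refl
  where
  X≡n+Y : X ≡ n + Y
  X≡n+Y = +-cancelʳ-≡ b X (n + Y) (trans e (rearrange Y b n))
    where
    rearrange : ∀ Y b n → Y + (b + n) ≡ n + Y + b
    rearrange = solve-∀
∣-transfer {n} {X} {Y} {a} e (inj₂ (inj₂ refl)) n∣X =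
  subst (n ∣_) X+n≡Y (∣m∣n⇒∣m+n n∣X ∣-refl)
  where
  X+n≡Y : X + n ≡ Y
  X+n≡Y = +-cancelʳ-≡ a (X + n) Y (trans (rearrange X a n) e)
    where
    rearrange : ∀ X a n → X + n + a ≡ X + (a + n)
    rearrange = solve-∀

pair-≤ : ∀ {cₛ cₜ aₛ aₜ bₛ bₜ} → cₛ ≤ suc cₜ → cₜ * suc aₜ ≡ cₜ * bₜ → cₛ * aₛ ≤ cₛ * suc bₛ →
  cₛ * aₛ + cₜ * aₜ ≤ suc (cₛ * bₛ + cₜ * bₜ)
pair-≤ {cₛ} {cₜ} {aₛ} {aₜ} {bₛ} {bₜ} cₛ≤1+cₜ target source = +-cancelʳ-≤ cₜ _ _ (begin
  cₛ * aₛ + cₜ * aₜ + cₜ         ≡⟨ lhs cₛ cₜ aₛ aₜ ⟩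
  cₛ * aₛ + cₜ * suc aₜ          ≤⟨ +-mono-≤ source (≤-reflexive target) ⟩
  cₛ * suc bₛ + cₜ * bₜ          ≡⟨ rhs cₛ bₛ (cₜ * bₜ) ⟩
  cₛ + (cₛ * bₛ + cₜ * bₜ)       ≤⟨ +-monoˡ-≤ _ cₛ≤1+cₜ ⟩
  suc cₜ + (cₛ * bₛ + cₜ * bₜ)   ≡⟨ +-comm (suc cₜ) _ ⟩
  (cₛ * bₛ + cₜ * bₜ) + suc cₜ   ≡⟨ +-suc _ cₜ ⟩
  suc (cₛ * bₛ + cₜ * bₜ) + cₜ   ∎)
  where
  open ≤-Reasoning
  lhs : ∀ c c′ a a′ → c * a + c′ * a′ + c′ ≡ c * a + c′ * suc a′
  lhs = solve-∀
  rhs : ∀ c b t → c * suc b + t ≡ c + (c * b + t)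
  rhs = solve-∀

pair-≡ : ∀ {cₛ cₜ aₛ aₜ bₛ bₜ} → cₛ ≡ suc cₜ → cₜ * suc aₜ ≡ cₜ * bₜ → aₛ ≡ suc bₛ →
  cₛ * aₛ + cₜ * aₜ ≡ suc (cₛ * bₛ + cₜ * bₜ)
pair-≡ {cₜ = cₜ} {aₜ = aₜ} {bₛ} refl target refl = begin
  suc cₜ * suc bₛ + cₜ * aₜ        ≡⟨ rearrange cₜ aₜ bₛ ⟩
  suc (suc cₜ * bₛ + cₜ * suc aₜ)  ≡⟨ cong (λ t → suc (suc cₜ * bₛ + t)) target ⟩
  suc (suc cₜ * bₛ + _)            ∎
  where
  open ≡-Reasoning
  rearrange : ∀ c a b → suc c * suc b + c * a ≡ suc (suc c * b + c * suc a)
  rearrange = solve-∀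

cancel-≤ : ∀ {X Y a b} → X + b ≡ Y + a → a ≤ suc b → X ≤ suc Y
cancel-≤ {X} {Y} {a} {b} e a≤1+b = +-cancelʳ-≤ b X (suc Y) (begin
  X + b        ≡⟨ e ⟩
  Y + a        ≤⟨ +-monoʳ-≤ Y a≤1+b ⟩
  Y + suc b    ≡⟨ +-suc Y b ⟩
  suc Y + b    ∎)
  where open ≤-Reasoning

cancel-≡ : ∀ {X Y a b} → X + b ≡ Y + a → a ≡ suc b → X ≡ suc Y
cancel-≡ {X} {Y} {b = b} e refl = +-cancelʳ-≡ b X (suc Y) (trans e (+-suc Y b))

-- Shifts

source target : Dir → ℕ → ℕ
source L i = suc i
source R i = i
target L i = i
target R i = suc i

source+target : ∀ (f : ℕ → ℕ) d i → f (source d i) + f (target d i) ≡ f i + f (suc i)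
source+target f L i = +-comm (f (suc i)) (f i)
source+target f R i = refl

≢source∧≢target : ∀ {j} d i → j ≢ source d i → j ≢ target d i → j ≢ i × j ≢ suc i
≢source∧≢target L i j≢s j≢t = j≢t , j≢s
≢source∧≢target R i j≢s j≢t = j≢s , j≢t

Shift-intro : ∀ {n m d i x y} → i ≤ m → (∀ j → j ≢ i → j ≢ suc i → y j ≡ x j) →
  IncAt n m (target d i) (x (target d i)) (y (target d i)) →
  DecAt n m (source d i) (x (source d i)) (y (source d i)) →
  Shift n m d i x y
Shift-intro {d = L} i≤m agree inc dec = i≤m , (λ j _ → agree j) , inc , dec
Shift-intro {d = R} i≤m agree inc dec = i≤m , (λ j _ → agree j) , dec , inc

Shift-target : ∀ {n m d i x y} → Shift n m d i x y →
  IncAt n m (target d i) (x (target d i)) (y (target d i))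
Shift-target {d = L} (_ , _ , inc , _) = inc
Shift-target {d = R} (_ , _ , _ , inc) = inc

Shift-source : ∀ {n m d i x y} → Shift n m d i x y →
  DecAt n m (source d i) (x (source d i)) (y (source d i))
Shift-source {d = L} (_ , _ , _ , dec) = dec
Shift-source {d = R} (_ , _ , dec , _) = dec

isBucket? : ∀ m j → Dec (IsBucket m j)
isBucket? m j = (j ≟ 0) ⊎-dec (j ≟ suc m)

bucket⇒≡0 : ∀ {m j} → IsBucket m j → j ≤ m → j ≡ 0
bucket⇒≡0 (inj₁ j≡0)  _   = j≡0
bucket⇒≡0 (inj₂ refl) j≤m = contradiction j≤m 1+n≰n

suc-bucket⇒≡m : ∀ {m i} → IsBucket m (suc i) → i ≡ m
suc-bucket⇒≡m (inj₂ 1+i≡1+m) = suc-injective 1+i≡1+m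

inc-cases : ∀ {n m j a b} → IncAt n m j a b → b ≡ suc a ⊎ (IsBucket m j × suc a ≡ n × b ≡ 0)
inc-cases {m = m} {j} {a} (atBucket , inner) with isBucket? m j
... | no  ¬bucket = inj₁ (trans (inner ¬bucket) (+-comm a 1))
... | yes bucket  with atBucket bucket
...   | inj₁ b≡a+1        = inj₁ (trans b≡a+1 (+-comm a 1))
...   | inj₂ (a+1≡n , b≡0) = inj₂ (bucket , trans (+-comm 1 a) a+1≡n , b≡0)

inc-weighted : ∀ {n m j a b} c → IncAt n m j a b → (IsBucket m j → c ≡ 0) → c * suc a ≡ c * b
inc-weighted c inc zeroAtBucket with inc-cases inc
... | inj₁ refl                 = refl
... | inj₂ (bucket , _ , refl) rewrite zeroAtBucket bucket = refl

dec-weighted : ∀ {n m j a b} c → DecAt n m j a b → c * a ≤ c * suc b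
dec-weighted c dec with inc-cases dec
... | inj₁ refl          = ≤-refl
... | inj₂ (_ , _ , refl) = ≤-trans (≤-reflexive (*-zeroʳ c)) z≤n

dec-exact : ∀ {n m j a b} → DecAt n m j a b → a ≢ 0 → a ≡ suc b
dec-exact dec a≢0 with inc-cases dec
... | inj₁ a≡1+b          = a≡1+b
... | inj₂ (_ , _ , a≡0)  = contradiction a≡0 a≢0

dec+inc-upToWrap : ∀ {n m jₛ jₜ aₛ aₜ bₛ bₜ} → DecAt n m jₛ aₛ bₛ → IncAt n m jₜ aₜ bₜ →
  UpToWrap n (aₛ + aₜ) (bₛ + bₜ)
dec+inc-upToWrap {aₜ = aₜ} {bₛ} dec inc with inc-cases dec | inc-cases inc
... | inj₁ refl              | inj₁ refl              = inj₁ (sym (+-suc bₛ aₜ))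
... | inj₁ refl              | inj₂ (_ , refl , refl) = inj₂ (inj₁ (rearrange bₛ aₜ))
  where
  rearrange : ∀ b a → suc (b + a) ≡ b + 0 + suc a
  rearrange = solve-∀
... | inj₂ (_ , refl , refl) | inj₁ refl              = inj₂ (inj₂ (rearrange bₛ aₜ))
  where
  rearrange : ∀ b a → b + suc a ≡ 0 + a + suc b
  rearrange = solve-∀
... | inj₂ (_ , refl , refl) | inj₂ (_ , refl , refl) = inj₁ (sym (+-identityʳ bₛ))

shift-upToWrap : ∀ {n m d i x y} → Shift n m d i x y → UpToWrap n (x i + x (suc i)) (y i + y (suc i))
shift-upToWrap {d = d} {i} {x} {y} sh = subst₂ (UpToWrap _) (source+target x d i) (source+target y d i)
  (dec+inc-upToWrap (Shift-source sh) (Shift-target sh))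

shift-preserves-∣sumBelow : ∀ {n m d i x y K} → Shift n m d i x y → K ≤ suc (suc m) → suc i ≢ K →
  n ∣ sumBelow x K → n ∣ sumBelow y K
shift-preserves-∣sumBelow {m = m} {i = i} {x} {y} {K} sh@(i≤m , agree , _) K≤2+m 1+i≢K n∣x with <-cmp (suc i) K
... | tri< 1+i<K _ _ = ∣-transfer (sumBelow-exchange K 1+i<K agree<K) (shift-upToWrap sh) n∣x
  where
  agree<K : ∀ j → j < K → j ≢ i → j ≢ suc i → x j ≡ y j
  agree<K j j<K j≢i j≢1+i = sym (agree j (s≤s⁻¹ (≤-trans j<K K≤2+m)) j≢i j≢1+i)
... | tri≈ _ 1+i≡K _ = contradiction 1+i≡K 1+i≢K
... | tri> _ _ K<1+i =
  subst (_ ∣_) (sumBelow-cong K (λ j j<K → sym (agree j (j≤1+m j<K) (j≢i j<K) (j≢1+i j<K)))) n∣x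
  where
  j<i : ∀ {j} → j < K → j < i
  j<i j<K = <-≤-trans j<K (s≤s⁻¹ K<1+i)
  j≤1+m : ∀ {j} → j < K → j ≤ suc m
  j≤1+m j<K = ≤-trans (<⇒≤ (j<i j<K)) (m≤n⇒m≤1+n i≤m)
  j≢i : ∀ {j} → j < K → j ≢ i
  j≢i j<K = <⇒≢ (j<i j<K)
  j≢1+i : ∀ {j} → j < K → j ≢ suc i
  j≢1+i j<K = <⇒≢ (m<n⇒m<1+n (j<i j<K))

-- Weighted potentials

potential : ℕ → (ℕ → ℕ) → Vtx → ℕ
potential m w x = sumBelow (λ j → w j * x j) (suc (suc m))

potential-zero : ∀ {m x} w → IsZeroVertex m x → potential m w x ≡ 0
potential-zero {m} {x} w zero-x =
  sumBelow-≡0 (suc (suc m)) (λ j j<2+m → trans (cong (w j *_) (zero-x j (s≤s⁻¹ j<2+m))) (*-zeroʳ (w j)))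

potential-shift : ∀ {n m d i x y} w → Shift n m d i x y →
  potential m w x + (w i * y i + w (suc i) * y (suc i)) ≡
  potential m w y + (w i * x i + w (suc i) * x (suc i))
potential-shift {m = m} w (i≤m , agree , _) =
  sumBelow-exchange (suc (suc m)) (s≤s (s≤s i≤m))
    (λ j j<2+m j≢i j≢1+i → cong (w j *_) (sym (agree j (s≤s⁻¹ j<2+m) j≢i j≢1+i)))

potential-shift-≤ : ∀ {n m d i x y} w → Shift n m d i x y →
  w (source d i) ≤ suc (w (target d i)) → (IsBucket m (target d i) → w (target d i) ≡ 0) →
  potential m w x ≤ suc (potential m w y)
potential-shift-≤ {d = d} {i} {x} {y} w sh w-step zeroAtBucket = cancel-≤ (potential-shift w sh)
  (subst₂ (λ a b → a ≤ suc b) (source+target (λ j → w j * x j) d i) (source+target (λ j → w j * y j) d i)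
    (pair-≤ w-step (inc-weighted (w (target d i)) (Shift-target sh) zeroAtBucket)
                   (dec-weighted (w (source d i)) (Shift-source sh))))

potential-shift-≡ : ∀ {n m d i x y} w → Shift n m d i x y → x (source d i) ≢ 0 →
  w (source d i) ≡ suc (w (target d i)) → (IsBucket m (target d i) → w (target d i) ≡ 0) →
  potential m w x ≡ suc (potential m w y)
potential-shift-≡ {d = d} {i} {x} {y} w sh xₛ≢0 w-step zeroAtBucket = cancel-≡ (potential-shift w sh)
  (subst₂ (λ a b → a ≡ suc b) (source+target (λ j → w j * x j) d i) (source+target (λ j → w j * y j) d i)
    (pair-≡ w-step (inc-weighted (w (target d i)) (Shift-target sh) zeroAtBucket)
                   (dec-exact (Shift-source sh) xₛ≢0)))

-- weight m c is w_p for the cut c = p + 1: coordinates j < c are those at or left of the wall.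
weight : ℕ → ℕ → ℕ → ℕ
weight m c j with j <? c
... | yes _ = j
... | no  _ = suc m ∸ j

weight-below : ∀ {m c j} → j < c → weight m c j ≡ j
weight-below {c = c} {j} j<c with j <? c
... | yes _   = refl
... | no  j≮c = contradiction j<c j≮c

weight-above : ∀ {m c j} → c ≤ j → weight m c j ≡ suc m ∸ j
weight-above {c = c} {j} c≤j with j <? c
... | yes j<c = contradiction c≤j (<⇒≱ j<c)
... | no  _   = refl

weight-ascends : ∀ {m c i} → suc i < c → weight m c (suc i) ≡ suc (weight m c i)
weight-ascends 1+i<c = trans (weight-below 1+i<c) (cong suc (sym (weight-below (<-trans (n<1+n _) 1+i<c))))

weight-descends : ∀ {m c i} → c ≤ i → i ≤ m → weight m c i ≡ suc (weight m c (suc i))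
weight-descends c≤i i≤m =
  trans (weight-above c≤i) (trans (+-∸-assoc 1 i≤m) (cong suc (sym (weight-above (m≤n⇒m≤1+n c≤i)))))

weight-source≤1+target : ∀ {m c} d {i} → suc i ≢ c → i ≤ m →
  weight m c (source d i) ≤ suc (weight m c (target d i))
weight-source≤1+target {c = c} d {i} 1+i≢c i≤m with <-cmp (suc i) c
weight-source≤1+target L _     _   | tri< 1+i<c _ _ = ≤-reflexive (weight-ascends 1+i<c)
weight-source≤1+target R _     _   | tri< 1+i<c _ _ =
  ≤-trans (n≤1+n _) (≤-trans (≤-reflexive (sym (weight-ascends 1+i<c))) (n≤1+n _))
weight-source≤1+target d 1+i≢c _   | tri≈ _ 1+i≡c _ = contradiction 1+i≡c 1+i≢c
weight-source≤1+target L _     i≤m | tri> _ _ c<1+i =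
  ≤-trans (n≤1+n _) (≤-trans (≤-reflexive (sym (weight-descends (s≤s⁻¹ c<1+i) i≤m))) (n≤1+n _))
weight-source≤1+target R _     i≤m | tri> _ _ c<1+i = ≤-reflexive (weight-descends (s≤s⁻¹ c<1+i) i≤m)

weight-bottom : ∀ {m c} → 0 < c → weight m c 0 ≡ 0
weight-bottom = weight-below

weight-top : ∀ {m c} → c ≤ suc m → weight m c (suc m) ≡ 0
weight-top {m} c≤1+m = trans (weight-above c≤1+m) (n∸n≡0 (suc m))

weight-inner≢0 : ∀ {m c j} → 0 < j → j ≤ m → weight m c j ≢ 0
weight-inner≢0 {m} {c} {j} 0<j j≤m with j <? c
... | yes _ = λ j≡0 → <⇒≢ 0<j (sym j≡0)
... | no  _ = λ w≡0 → 1+n≢0 (trans (sym (+-∸-assoc 1 j≤m)) w≡0)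

weight≢0⇒≤m : ∀ {m c j} → c ≤ j → j ≤ suc m → weight m c j ≢ 0 → j ≤ m
weight≢0⇒≤m c≤j j≤1+m w≢0 with m≤n⇒m<n∨m≡n j≤1+m
... | inj₁ j<1+m = s≤s⁻¹ j<1+m
... | inj₂ refl  = contradiction (weight-top c≤j) w≢0

-- cut p = p + 1 (InRange forces p ≥ -1).
cut : ℤ → ℕ
cut -[1+ _ ] = 0
cut (+ k)    = suc k

prefixSum≡sumBelow-cut : ∀ v p → prefixSum v p ≡ sumBelow v (cut p)
prefixSum≡sumBelow-cut v -[1+ _ ] = refl
prefixSum≡sumBelow-cut v (+ k)    = refl

cut-≤ : ∀ {m p} → InRange m p → cut p ≤ suc (suc m)
cut-≤ { p = -[1+ _ ] } _   = z≤n
cut-≤ { p = + k }      k≤ = s≤s k≤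

notBlocked⇒≢cut : ∀ {m p d i} → NotBlockedBy m p (d , i) → suc i ≢ cut p
notBlocked⇒≢cut { p = -[1+ _ ] } _         = λ ()
notBlocked⇒≢cut { p = + k }      (i≢k , _) = i≢k ∘ suc-injective

notBlocked⇒zeroAtBucket : ∀ {m p} d {i} → InRange m p → NotBlockedBy m p (d , i) → i ≤ m →
  IsBucket m (target d i) → weight m (cut p) (target d i) ≡ 0
notBlocked⇒zeroAtBucket { p = -[1+ _ ] } L _ notL0 i≤m bucket =
  contradiction (refl , bucket⇒≡0 bucket i≤m) notL0
notBlocked⇒zeroAtBucket {m} { p = + k } L _ _ i≤m bucket rewrite bucket⇒≡0 bucket i≤m =
  weight-bottom {m} {suc k} z<s
notBlocked⇒zeroAtBucket {m} { p = -[1+ _ ] } R _ _ _ bucket rewrite suc-bucket⇒≡m bucket =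
  weight-top {m} z≤n
notBlocked⇒zeroAtBucket {m} { p = + k } R k≤1+m (_ , notRm) _ bucket rewrite suc-bucket⇒≡m bucket =
  weight-top {m} (≤∧≢⇒< k≤1+m (λ k≡1+m → notRm k≡1+m (refl , refl)))

left-of-cut⇒notBlocked : ∀ {m p i} → suc (suc i) ≤ cut p → NotBlockedBy m p (L , i)
left-of-cut⇒notBlocked { p = + k } 2+i≤1+k = (λ i≡k → <⇒≢ (s≤s⁻¹ 2+i≤1+k) i≡k) , λ _ ()

right-of-cut⇒notBlocked : ∀ {m p i} → cut p ≤ i → i ≤ m → NotBlockedBy m p (R , i)
right-of-cut⇒notBlocked { p = -[1+ _ ] } _     _   = λ ()
right-of-cut⇒notBlocked { p = + k }      1+k≤i i≤m =
  (λ i≡k → <⇒≢ 1+k≤i (sym i≡k)) ,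
  λ { refl (_ , refl) → contradiction (≤-trans (n≤1+n _) (≤-trans 1+k≤i i≤m)) 1+n≰n }

potential-≤-pathLength : ∀ {n m p x} → InRange m p → (P : Path n m x) → IsWall p P →
  potential m (weight m (cut p)) x ≤ pathLength P
potential-≤-pathLength {m = m} {p} _ (done zero-x) _ = ≤-reflexive (potential-zero (weight m (cut p)) zero-x)
potential-≤-pathLength {m = m} {p} inRange (step d i sh _ rest) (notBlocked ∷ walls) = ≤-trans
  (potential-shift-≤ (weight m (cut p)) sh (weight-source≤1+target d (notBlocked⇒≢cut notBlocked) (proj₁ sh))
    (notBlocked⇒zeroAtBucket d inRange notBlocked (proj₁ sh)))
  (s≤s (potential-≤-pathLength inRange rest walls))

-- Descending to 0 one unit of potential at a time

update₂ : Vtx → ℕ → ℕ → ℕ → Vtx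
update₂ x i a b j with j ≟ i | j ≟ suc i
... | yes _ | _     = a
... | no  _ | yes _ = b
... | no  _ | no  _ = x j

update₂-at : ∀ x i a b → update₂ x i a b i ≡ a
update₂-at x i a b with i ≟ i | i ≟ suc i
... | yes _   | _ = refl
... | no  i≢i | _ = contradiction refl i≢i

update₂-at-suc : ∀ x i a b → update₂ x i a b (suc i) ≡ b
update₂-at-suc x i a b with suc i ≟ i | suc i ≟ suc i
... | yes 1+i≡i | _           = contradiction 1+i≡i 1+n≢n
... | no  _     | yes _       = refl
... | no  _     | no  1+i≢1+i = contradiction refl 1+i≢1+i

update₂-elsewhere : ∀ x i a b {j} → j ≢ i → j ≢ suc i → update₂ x i a b j ≡ x j
update₂-elsewhere x i a b {j} j≢i j≢1+i with j ≟ i | j ≟ suc i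
... | yes j≡i | _         = contradiction j≡i j≢i
... | no  _   | yes j≡1+i = contradiction j≡1+i j≢1+i
... | no  _   | no  _     = refl

-- Only buckets count modulo n: an inner coordinate goes from 0 to 1 even when n = 1.
incAt : ℕ → ℕ → ℕ → ℕ → ℕ
incAt n m j a with isBucket? m j | suc a ≟ n
... | yes _ | yes _ = 0
... | yes _ | no  _ = suc a
... | no  _ | _     = suc a

incAt-IncAt : ∀ n m j a → IncAt n m j a (incAt n m j a)
incAt-IncAt n m j a with isBucket? m j | suc a ≟ n
... | yes bucket | yes 1+a≡n =
  (λ _ → inj₂ (trans (+-comm a 1) 1+a≡n , refl)) , λ ¬bucket → contradiction bucket ¬bucket
... | yes _      | no  _     = (λ _ → inj₁ (+-comm 1 a)) , λ _ → +-comm 1 a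
... | no  _      | _         = (λ _ → inj₁ (+-comm 1 a)) , λ _ → +-comm 1 a

incAt-≤ : ∀ n m j a → incAt n m j a ≤ suc a
incAt-≤ n m j a with isBucket? m j | suc a ≟ n
... | yes _ | yes _ = z≤n
... | yes _ | no  _ = ≤-refl
... | no  _ | _     = ≤-refl

incAt-< : ∀ {n m j a} → IsBucket m j → a < n → incAt n m j a < n
incAt-< {n} {m} {j} {a} bucket a<n with isBucket? m j | suc a ≟ n
... | yes _ | yes _     = ≤-<-trans z≤n a<n
... | yes _ | no  1+a≢n = ≤∧≢⇒< a<n 1+a≢n
... | no  ¬bucket | _   = contradiction bucket ¬bucket

DecAt-∸1 : ∀ {n m j a} → a ≢ 0 → DecAt n m j a (a ∸ 1)
DecAt-∸1 {a = a} a≢0 = (λ _ → inj₁ a≡a∸1+1) , λ _ → a≡a∸1+1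
  where
  a≡a∸1+1 : a ≡ a ∸ 1 + 1
  a≡a∸1+1 = sym (m∸n+n≡m (n≢0⇒n>0 a≢0))

shiftAt : ℕ → ℕ → Dir → ℕ → Vtx → Vtx
shiftAt n m L i x = update₂ x i (incAt n m i (x i)) (x (suc i) ∸ 1)
shiftAt n m R i x = update₂ x i (x i ∸ 1) (incAt n m (suc i) (x (suc i)))

shiftAt-source : ∀ n m d i x → shiftAt n m d i x (source d i) ≡ x (source d i) ∸ 1
shiftAt-source n m L i x = update₂-at-suc x i _ _
shiftAt-source n m R i x = update₂-at x i _ _

shiftAt-target : ∀ n m d i x → shiftAt n m d i x (target d i) ≡ incAt n m (target d i) (x (target d i))
shiftAt-target n m L i x = update₂-at x i _ _
shiftAt-target n m R i x = update₂-at-suc x i _ _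

shiftAt-elsewhere : ∀ n m d i x {j} → j ≢ i → j ≢ suc i → shiftAt n m d i x j ≡ x j
shiftAt-elsewhere n m L i x = update₂-elsewhere x i _ _
shiftAt-elsewhere n m R i x = update₂-elsewhere x i _ _

shiftAt-Shift : ∀ {n m} d {i x} → i ≤ m → x (source d i) ≢ 0 → Shift n m d i x (shiftAt n m d i x)
shiftAt-Shift {n} {m} d {i} {x} i≤m xₛ≢0 = Shift-intro i≤m (λ j → shiftAt-elsewhere n m d i x)
  (subst (IncAt n m (target d i) (x (target d i))) (sym (shiftAt-target n m d i x)) (incAt-IncAt n m _ _))
  (subst (DecAt n m (source d i) (x (source d i))) (sym (shiftAt-source n m d i x)) (DecAt-∸1 xₛ≢0))

Admissible : ℕ → ℕ → ℕ → ℕ → Set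
Admissible n m j a = (j ≡ 0 → a < n) × (j ≡ suc m → a < n) × (0 < j → j ≤ m → a ≤ 1)

IsVertex⇒Admissible : ∀ {n m x} → IsVertex n m x → ∀ j → Admissible n m j (x j)
IsVertex⇒Admissible (x₀<n , xₘ₊₁<n , inner , _) j = (λ { refl → x₀<n }) , (λ { refl → xₘ₊₁<n }) , inner j

Admissible⇒IsVertex : ∀ {n m y} → (∀ j → Admissible n m j (y j)) → n ∣ sumBelow y (suc (suc m)) →
  IsVertex n m y
Admissible⇒IsVertex {m = m} admissible n∣total =
  proj₁ (admissible 0) refl , proj₁ (proj₂ (admissible (suc m))) refl ,
  (λ j → proj₂ (proj₂ (admissible j))) , n∣total

Admissible-≤ : ∀ {n m j a b} → b ≤ a → Admissible n m j a → Admissible n m j b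
Admissible-≤ b≤a (at0 , atTop , inner) =
  (≤-<-trans b≤a ∘ at0) , (≤-<-trans b≤a ∘ atTop) , (λ 0<j j≤m → ≤-trans b≤a (inner 0<j j≤m))

Admissible-incAt : ∀ {n m j a} → Admissible n m j a → IsBucket m j ⊎ a ≡ 0 → Admissible n m j (incAt n m j a)
Admissible-incAt {n} {m} {j} {a} (at0 , atTop , _) room =
  (λ j≡0 → incAt-< (inj₁ j≡0) (at0 j≡0)) , (λ j≡1+m → incAt-< (inj₂ j≡1+m) (atTop j≡1+m)) , inner room
  where
  inner : IsBucket m j ⊎ a ≡ 0 → 0 < j → j ≤ m → incAt n m j a ≤ 1
  inner (inj₁ bucket) 0<j j≤m = contradiction (bucket⇒≡0 bucket j≤m) (≢-sym (<⇒≢ 0<j))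
  inner (inj₂ refl)   _   _   = incAt-≤ n m j 0

shiftAt-IsVertex : ∀ {n m} d {i x} → IsVertex n m x → i ≤ m → x (source d i) ≢ 0 →
  IsBucket m (target d i) ⊎ x (target d i) ≡ 0 → IsVertex n m (shiftAt n m d i x)
shiftAt-IsVertex {n} {m} d {i} {x} isVertex i≤m xₛ≢0 room =
  Admissible⇒IsVertex admissible
    (shift-preserves-∣sumBelow (shiftAt-Shift d i≤m xₛ≢0) ≤-refl (<⇒≢ (s≤s (s≤s i≤m))) n∣total)
  where
  n∣total : n ∣ sumBelow x (suc (suc m))
  n∣total = proj₂ (proj₂ (proj₂ isVertex))
  admissible : ∀ j → Admissible n m j (shiftAt n m d i x j)
  admissible j with j ≟ source d i | j ≟ target d i
  ... | yes refl | _        = subst (Admissible n m j) (sym (shiftAt-source n m d i x))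
                                (Admissible-≤ (m∸n≤m _ 1) (IsVertex⇒Admissible isVertex j))
  ... | no  _    | yes refl = subst (Admissible n m j) (sym (shiftAt-target n m d i x))
                                (Admissible-incAt (IsVertex⇒Admissible isVertex j) room)
  ... | no  j≢s  | no  j≢t  = subst (Admissible n m j)
                                (sym (shiftAt-elsewhere n m d i x (proj₁ j≢) (proj₂ j≢)))
                                (IsVertex⇒Admissible isVertex j)
    where
    j≢ : j ≢ i × j ≢ suc i
    j≢ = ≢source∧≢target d i j≢s j≢t

potential≡0⇒IsZeroVertex : ∀ {n m c x} → IsVertex n m x → c ≤ suc (suc m) → n ∣ sumBelow x c →
  potential m (weight m c) x ≡ 0 → IsZeroVertex m x
potential≡0⇒IsZeroVertex {n} {m} {c} {x} (x₀<n , xₘ₊₁<n , _ , n∣total) c≤2+m n∣prefix Φ≡0 = zero-at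
  where
  vanishes : ∀ {j} → j ≤ suc m → weight m c j ≢ 0 → x j ≡ 0
  vanishes {j} j≤1+m w≢0 with m*n≡0⇒m≡0∨n≡0 (weight m c j) (sumBelow≡0⇒≡0 (suc (suc m)) Φ≡0 j (s≤s j≤1+m))
  ... | inj₁ w≡0 = contradiction w≡0 w≢0
  ... | inj₂ x≡0 = x≡0
  inner : ∀ {j} → 0 < j → j ≤ m → x j ≡ 0
  inner 0<j j≤m = vanishes (m≤n⇒m≤1+n j≤m) (weight-inner≢0 {c = c} 0<j j≤m)
  left : ∀ j → 0 < j → j < c → x j ≡ 0
  left j 0<j j<c =
    vanishes (s≤s⁻¹ (≤-trans j<c c≤2+m)) (λ w≡0 → <⇒≢ 0<j (sym (trans (sym (weight-below j<c)) w≡0)))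
  bottom : x 0 ≡ 0
  bottom with 0 <? c
  ... | yes 0<c = ∣∧<⇒≡0 (subst (n ∣_) (sumBelow-head 0<c left) n∣prefix) x₀<n
  ... | no  0≮c = vanishes z≤n (λ w≡0 → 1+n≢0 (trans (sym (weight-above (≮⇒≥ 0≮c))) w≡0))
  below-top : ∀ j → j < suc m → x j ≡ 0
  below-top zero    _   = bottom
  below-top (suc j) j<m = inner z<s (s≤s⁻¹ j<m)
  top : x (suc m) ≡ 0
  top = ∣∧<⇒≡0 (subst (n ∣_) (cong (_+ x (suc m)) (sumBelow-≡0 (suc m) below-top)) n∣total) xₘ₊₁<n
  zero-at : IsZeroVertex m x
  zero-at zero    _       = bottom
  zero-at (suc j) 1+j≤1+m with m≤n⇒m<n∨m≡n (s≤s⁻¹ 1+j≤1+m)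
  ... | inj₁ j<m  = inner z<s j<m
  ... | inj₂ refl = top

record Descent (n m : ℕ) (p : ℤ) (x : Vtx) : Set where
  constructor descent
  field
    dir        : Dir
    position   : ℕ
    next       : Vtx
    shift      : Shift n m dir position x next
    isVertex   : IsVertex n m next
    notBlocked : NotBlockedBy m p (dir , position)
    isPivot    : n ∣ prefixSum next p
    decrease   : potential m (weight m (cut p)) x ≡ suc (potential m (weight m (cut p)) next)

shiftAt-Descent : ∀ {n m p x} d {i} → InRange m p → IsVertex n m x → n ∣ prefixSum x p → i ≤ m →
  x (source d i) ≢ 0 → IsBucket m (target d i) ⊎ x (target d i) ≡ 0 → NotBlockedBy m p (d , i) →
  weight m (cut p) (source d i) ≡ suc (weight m (cut p) (target d i)) →
  (IsBucket m (target d i) → weight m (cut p) (target d i) ≡ 0) → Descent n m p x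
shiftAt-Descent {n} {m} {p} {x} d {i} inRange isVertex isPivot i≤m xₛ≢0 room notBlocked w-step zeroAtBucket =
  descent d i (shiftAt n m d i x) sh (shiftAt-IsVertex d isVertex i≤m xₛ≢0 room) notBlocked
    (subst (n ∣_) (sym (prefixSum≡sumBelow-cut _ p))
      (shift-preserves-∣sumBelow sh (cut-≤ inRange) (notBlocked⇒≢cut notBlocked)
        (subst (n ∣_) (prefixSum≡sumBelow-cut x p) isPivot)))
    (potential-shift-≡ (weight m (cut p)) sh xₛ≢0 w-step zeroAtBucket)
  where
  sh : Shift n m d i x (shiftAt n m d i x)
  sh = shiftAt-Shift d i≤m xₛ≢0

nonzero-with-free-left : ∀ (x : Vtx) j → x (suc j) ≢ 0 → ∃[ i ] i ≤ j × x (suc i) ≢ 0 × (i ≡ 0 ⊎ x i ≡ 0)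
nonzero-with-free-left x zero    x₁≢0 = 0 , z≤n , x₁≢0 , inj₁ refl
nonzero-with-free-left x (suc j) x≢0 with x (suc j) ≟ 0
... | yes x≡0 = suc j , ≤-refl , x≢0 , inj₂ x≡0
... | no  x≢0′ with nonzero-with-free-left x j x≢0′
...   | i , i≤j , xᵢ₊₁≢0 , free = i , m≤n⇒m≤1+n i≤j , xᵢ₊₁≢0 , free

nonzero-with-free-right : ∀ (x : Vtx) {m} d j → d + j ≡ m → x j ≢ 0 →
  ∃[ i ] j ≤ i × i ≤ m × x i ≢ 0 × (i ≡ m ⊎ x (suc i) ≡ 0)
nonzero-with-free-right x zero    j refl xⱼ≢0 = j , ≤-refl , ≤-refl , xⱼ≢0 , inj₁ refl
nonzero-with-free-right x (suc d) j refl xⱼ≢0 with x (suc j) ≟ 0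
... | yes x≡0 = j , ≤-refl , m≤n+m j (suc d) , xⱼ≢0 , inj₂ x≡0
... | no  x≢0 with nonzero-with-free-right x d (suc j) (+-suc d j) x≢0
...   | i , 1+j≤i , i≤m , xᵢ≢0 , free = i , ≤-trans (n≤1+n j) 1+j≤i , i≤m , xᵢ≢0 , free

descent-leftward : ∀ {n m p x} → InRange m p → IsVertex n m x → n ∣ prefixSum x p →
  ∀ j → weight m (cut p) j ≢ 0 → x j ≢ 0 → j < cut p → Descent n m p x
descent-leftward {m = m} {p} _ _ _ zero w≢0 _ 0<c = contradiction (weight-bottom {m} 0<c) w≢0
descent-leftward {m = m} {p} {x} inRange isVertex isPivot (suc j) _ xⱼ≢0 j<c
  with nonzero-with-free-left x j xⱼ≢0
... | i , i≤j , xᵢ₊₁≢0 , free =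
  shiftAt-Descent L inRange isVertex isPivot i≤m xᵢ₊₁≢0 (map₁ inj₁ free) (left-of-cut⇒notBlocked 2+i≤c)
    (weight-ascends 2+i≤c) (λ bucket → trans (weight-below (<-trans (n<1+n i) 2+i≤c)) (bucket⇒≡0 bucket i≤m))
  where
  2+i≤c : suc (suc i) ≤ cut p
  2+i≤c = ≤-<-trans (s≤s i≤j) j<c
  i≤m : i ≤ m
  i≤m = s≤s⁻¹ (s≤s⁻¹ (≤-trans 2+i≤c (cut-≤ inRange)))

descent-rightward : ∀ {n m p x} → InRange m p → IsVertex n m x → n ∣ prefixSum x p →
  ∀ j → x j ≢ 0 → cut p ≤ j → j ≤ m → Descent n m p x
descent-rightward {m = m} {p} {x} inRange isVertex isPivot j xⱼ≢0 c≤j j≤m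
  with nonzero-with-free-right x (m ∸ j) j (m∸n+n≡m j≤m) xⱼ≢0
... | i , j≤i , i≤m , xᵢ≢0 , free =
  shiftAt-Descent R inRange isVertex isPivot i≤m xᵢ≢0 (map₁ (inj₂ ∘ cong suc) free)
    (right-of-cut⇒notBlocked c≤i i≤m) (weight-descends c≤i i≤m)
    (λ bucket → subst (λ k → weight m (cut p) (suc k) ≡ 0) (sym (suc-bucket⇒≡m bucket))
                  (weight-top (m≤n⇒m≤1+n (≤-trans c≤i i≤m))))
  where
  c≤i : cut p ≤ i
  c≤i = ≤-trans c≤j j≤i

descent-exists : ∀ {n m p x} → InRange m p → IsVertex n m x → n ∣ prefixSum x p →
  potential m (weight m (cut p)) x ≢ 0 → Descent n m p x
descent-exists {m = m} {p} {x} inRange isVertex isPivot Φ≢0 with sumBelow≢0⇒∃≢0 (suc (suc m)) Φ≢0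
... | j , j<2+m , wx≢0 with *≢0⇒≢0 (weight m (cut p) j) (x j) wx≢0 | j <? cut p
...   | w≢0 , xⱼ≢0 | yes j<c = descent-leftward inRange isVertex isPivot j w≢0 xⱼ≢0 j<c
...   | w≢0 , xⱼ≢0 | no  j≮c = descent-rightward inRange isVertex isPivot j xⱼ≢0 (≮⇒≥ j≮c)
                                  (weight≢0⇒≤m (≮⇒≥ j≮c) (s≤s⁻¹ j<2+m) w≢0)

path-of-length-potential : ∀ {n m p} → InRange m p → ∀ t {x} → IsVertex n m x → n ∣ prefixSum x p →
  potential m (weight m (cut p)) x ≡ t → Σ (Path n m x) λ P → IsWall p P × pathLength P ≡ t
path-of-length-potential {n} {p = p} inRange zero {x} isVertex isPivot Φ≡0 =
  done (potential≡0⇒IsZeroVertex isVertex (cut-≤ inRange) isPivot′ Φ≡0) , [] , refl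
  where
  isPivot′ : n ∣ sumBelow x (cut p)
  isPivot′ = subst (_ ∣_) (prefixSum≡sumBelow-cut x p) isPivot
path-of-length-potential inRange (suc t) isVertex isPivot Φ≡1+t
  with descent-exists inRange isVertex isPivot (λ Φ≡0 → 1+n≢0 (trans (sym Φ≡1+t) Φ≡0))
... | descent d i y sh isVertexʸ notBlocked isPivotʸ decrease
  with path-of-length-potential inRange t isVertexʸ isPivotʸ (suc-injective (trans (sym decrease) Φ≡1+t))
... | P , walls , length≡t = step d i sh isVertexʸ P , notBlocked ∷ walls , cong suc length≡t

psFormula≡potential : ∀ {m p} v → InRange m p → psFormula m v p ≡ potential m (weight m (cut p)) v
psFormula≡potential {m} { -[1+ k ] } v _ = sym (begin
  potential m (weight m 0) v
    ≡⟨ sumBelow-cong (suc (suc m)) (λ j _ → cong (_* v j) (weight-above {m} {0} {j} z≤n)) ⟩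
  sumBelow F (suc m) + F (suc m)
    ≡⟨ cong (λ w → sumBelow F (suc m) + w * v (suc m)) (n∸n≡0 (suc m)) ⟩
  sumBelow F (suc m) + 0
    ≡⟨ +-identityʳ _ ⟩
  psFormula m v -[1+ k ]
    ∎)
  where
  open ≡-Reasoning
  F : ℕ → ℕ
  F i = (suc m ∸ i) * v i
psFormula≡potential {m} { + k } v k≤1+m = sym (begin
  potential m (weight m (suc k)) v
    ≡⟨ sumBelow-+ H 1 (suc m) ⟩
  H 0 + sumFrom H 1 (suc m)
    ≡⟨ cong (λ w → w * v 0 + sumFrom H 1 (suc m)) (weight-bottom {m} {suc k} z<s) ⟩
  sumFrom H 1 (suc m)
    ≡⟨ cong (sumFrom H 1) (sym (m+[n∸m]≡n k≤1+m)) ⟩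
  sumFrom H 1 (k + (suc m ∸ k))
    ≡⟨ sumBelow-+ (λ i → H (suc i)) k (suc m ∸ k) ⟩
  sumBelow (λ i → H (suc i)) k + sumFrom H (suc k) (suc m ∸ k)
    ≡⟨ cong₂ _+_ (sumBelow-cong k (λ i i<k → cong (_* v (suc i)) (weight-below (s≤s i<k))))
                 (sumBelow-cong (suc m ∸ k) (λ i _ →
                    cong (_* v (suc (k + i))) (weight-above (s≤s (m≤m+n k i))))) ⟩
  sumFrom (λ i → i * v i) 1 k + sumFrom F (suc k) (suc m ∸ k)
    ≡⟨ cong₂ _+_ refl (sumFrom-drop-top F m k (cong (_* v (suc m)) (n∸n≡0 (suc m)))) ⟩
  psFormula m v (+ k)
    ∎)
  where
  open ≡-Reasoning
  H F : ℕ → ℕ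
  H j = weight m (suc k) j * v j
  F i = (suc m ∸ i) * v i

psFormula≤innerBound : ∀ {m k} (v : Vtx) → (∀ i → 1 ≤ i → i ≤ m → v i ≤ 1) → k ≤ m →
  psFormula m v (+ k) ≤ innerBound m k
psFormula≤innerBound {m} {k} v inner k≤m = +-mono-≤ left right
  where
  d : ℕ
  d = m ∸ k
  left : sumFrom (λ i → i * v i) 1 k ≤ suc k C 2
  left = ≤-trans (sumBelow-mono-≤ k (λ i i<k → weighted≤ (suc i) (inner (suc i) z<s (≤-trans i<k k≤m))))
                 (≤-reflexive (triangle k))
  right : sumFrom (λ i → (suc m ∸ i) * v i) (suc k) d ≤ suc d C 2
  right = ≤-trans (sumBelow-mono-≤ d (λ i i<d →
                     ≤-trans (weighted≤ (m ∸ (k + i)) (inner (suc (k + i)) z<s (inside i<d)))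
                             (≤-reflexive (sym (∸-+-assoc m k i)))))
                  (≤-reflexive (trans (sumBelow-∸ d) (triangle d)))
    where
    inside : ∀ {i} → i < d → suc (k + i) ≤ m
    inside {i} i<d = subst (suc (k + i) ≤_) (m+[n∸m]≡n k≤m) (+-monoʳ-< k i<d)

corollary4p12 : (n m : ℕ) → 1 ≤ n → (v : Vtx) → IsVertex n m v →
    (p : ℤ) → IsPivot n m v p →
    IsPs n m v p (psFormula m v p) ×
    (∀ (k : ℕ) → p ≡ + k → k ≤ m → psFormula m v p ≤ innerBound m k)
corollary4p12 n m _ v isVertex p (inRange , isPivot) = (shortest , minimal) , bound
  where
  formula : psFormula m v p ≡ potential m (weight m (cut p)) v
  formula = psFormula≡potential v inRange
  shortest : Σ (Path n m v) λ P → IsWall p P × pathLength P ≡ psFormula m v p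
  shortest = path-of-length-potential inRange (psFormula m v p) isVertex isPivot (sym formula)
  minimal : ∀ P → IsWall p P → psFormula m v p ≤ pathLength P
  minimal P wall = subst (_≤ pathLength P) (sym formula) (potential-≤-pathLength inRange P wall)
  bound : ∀ k → p ≡ + k → k ≤ m → psFormula m v p ≤ innerBound m k
  bound k refl = psFormula≤innerBound v (proj₁ (proj₂ (proj₂ isVertex)))
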